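{- Let $1\le j\le k-1$ be integers and let $H=(V,E_1,E_2)$ be a double $k$-graph. For every positive integer $N\le \binom{|V|}{j}/\binom{k}{j}$, if $H$ $j$-percolates, then there exist $\mathcal{J}_0\subseteq V^{(j)}$, $\mathcal{E}_1\subseteq E_1$ and $\mathcal{E}_2\subseteq E_2$ such that $(\mathcal{J}_0,\mathcal{E}_1,\mathcal{E}_2)$ is an internally spanned triple of size $\ell$ for some $N\le \ell\le \binom{k}{j}N$.
   Context: For a set $V$, $V^{(i)}$ denotes the set of $i$-element subsets of $V$. A double $k$-graph $(V,E_1,E_2)$ consists of a vertex set $V$, red edges $E_1\subseteq V^{(k)}$ and blue edges $E_2\subseteq V^{(k)}$. $j$-jigsaw percolation of a collection $\mathcal{J}\subseteq V^{(j)}$ on $(V,E_1,E_2)$: start at time $0$ with the partition of $\mathcal{J}$ into singletons (clusters). Given the partition at time $t$, form an auxiliary graph on the clusters in which two distinct clusters $C,C'$ are adjacent iff there exist $J_1,J_2\in C$, $J_1',J_2'\in C'$, a red edge $e_1\in E_1$ with $J_1\cup J_1'\subseteq e_1$ and a blue edge $e_2\in E_2$ with $J_2\cup J_2'\subseteq e_2$. If the auxiliary graph has no edges, stop. Otherwise the partition at time $t+1$ consists of the unions of the clusters in each connected component of the auxiliary graph; if it has a single class, stop, else continue. $\mathcal{J}$ percolates on $(V,E_1,E_2)$ if the process ends with a single cluster; $(V,E_1,E_2)$ $j$-percolates if $V^{(j)}$ percolates on it. A triple $(\mathcal{J}_0,\mathcal{E}_1,\mathcal{E}_2)$ with $\mathcal{J}_0\subseteq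 V^{(j)}$, $\mathcal{E}_1,\mathcal{E}_2\subseteq V^{(k)}$ is internally spanned if $\mathcal{J}_0$ percolates on the double $k$-graph $(V,\mathcal{E}_1,\mathcal{E}_2)$; its size is $|\mathcal{J}_0|$. -}

module Defs where

open import Level using (0ℓ)
open import Data.Nat using (ℕ; zero; suc)
open import Data.Product using (Σ; ∃; _×_; _,_)
open import Data.Sum using (_⊎_)
open import Data.Fin.Subset as S using (Subset; _∪_; ∣_∣)
open import Relation.Nullary using (¬_)
open import Relation.Binary.PropositionalEquality using (_≡_)
open import Relation.Binary.Construct.Closure.Transitive using (TransClosure)

-- Vertex set V = Fin n; a subset of V is a 'Subset n'.
-- A family of subsets of V is a predicate on 'Subset n'.
Family : ℕ → Set₁
Family n = Subset n → Set

_⁽_⁾ : (n i : ℕ) → Family n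
(n ⁽ i ⁾) A = ∣ A ∣ ≡ i

record DoubleGraph (n k : ℕ) : Set₁ where
  field
    E₁ : Family n
    E₂ : Family n
    E₁-unif : ∀ e → E₁ e → ∣ e ∣ ≡ k
    E₂-unif : ∀ e → E₂ e → ∣ e ∣ ≡ k

module Jigsaw {n : ℕ} (𝒥 E₁ E₂ : Family n) where

  mutual
    -- Same t J J' : J, J' ∈ 𝒥 lie in the same cluster at time t
    Same : ℕ → Subset n → Subset n → Set
    Same zero J J' = 𝒥 J × J ≡ J'
    Same (suc t) = TransClosure (Step t)

    Step : ℕ → Subset n → Subset n → Set
    Step t J J' = Same t J J' ⊎ Adj t J J'

    Adj : ℕ → Subset n → Subset n → Set
    Adj t J J' =
      ¬ Same t J J' ×
      Σ (Subset n) λ J₁ → Σ (Subset n) λ J₂ → Σ (Subset n) λ J₁' → Σ (Subset n) λ J₂' →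
        Same t J J₁ × Same t J J₂ × Same t J' J₁' × Same t J' J₂' ×
        (Σ (Subset n) λ e₁ → E₁ e₁ × (J₁ ∪ J₁') S.⊆ e₁) ×
        (Σ (Subset n) λ e₂ → E₂ e₂ × (J₂ ∪ J₂') S.⊆ e₂)

  Percolates : Set
  Percolates = (Σ (Subset n) 𝒥) × ∃ λ t → ∀ J J' → 𝒥 J → 𝒥 J' → Same t J J'

Percolates : {n : ℕ} → Family n → Family n → Family n → Set
Percolates 𝒥 E₁ E₂ = Jigsaw.Percolates 𝒥 E₁ E₂

JPercolates : {n k : ℕ} → ℕ → DoubleGraph n k → Set
JPercolates {n} j H = Percolates (n ⁽ j ⁾) (DoubleGraph.E₁ H) (DoubleGraph.E₂ H)

-- Only the finitely many edges witnessing the percolation of V^(j) matter, and restricting E₁ and E₂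
-- to them makes the jigsaw process decidable. By induction on time, either some internally spanned
-- family of j-sets has size between N and (k C j)·N, or every cluster is an internally spanned family
-- of fewer than N j-sets. From time t to t+1 each new cluster is assembled by absorbing the old
-- clusters adjacent to it one at a time: two disjoint internally spanned families joined by a red and
-- a blue edge span their union, which has fewer than 2N ≤ (k C j)·N members, so the first union
-- reaching size N is in range. At the percolation time the cluster of a j-set is all of V^(j), of
-- size n C j ≥ N, so the first alternative must hold.
module Submission where

open import Defs
open import Level using (0ℓ)
open import Data.Bool using () renaming (_≟_ to _≟ᵇ_)
open import Data.Empty using (⊥-elim)
open import Data.Fin.Subset using (Subset; inside; outside; _∪_; ∣_∣)
import Data.Fin.Subset as S
open import Data.Fin.Subset.Properties using (anySubset?; _⊆?_; ∪-comm)
open import Data.List using (List; []; _∷_; _++_; map; length)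
open import Data.List.Properties using (length-++; length-map; length-++-sucʳ)
open import Data.List.Membership.Propositional using (_∈_; _∉_; find; lose)
import Data.List.Membership.DecPropositional as DecMembership
open import Data.List.Membership.Propositional.Properties
  using (∈-map⁺; ∈-map⁻; ∈-++⁺ˡ; ∈-++⁺ʳ; ∈-++⁻; ∈-∃++; ∈-length)
open import Data.List.Relation.Binary.Disjoint.Propositional using (Disjoint)
open import Data.List.Relation.Unary.All as All using (All; []; _∷_)
open import Data.List.Relation.Unary.All.Properties using (++⁺; ++⁻; ++⁻ˡ; ++⁻ʳ; map⁺)
open import Data.List.Relation.Unary.AllPairs using ([]; _∷_)
open import Data.List.Relation.Unary.Any using (here; there; any?)
open import Data.List.Relation.Unary.Unique.Propositional using (Unique)
import Data.List.Relation.Unary.Unique.Propositional.Properties as Unique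
open import Data.Nat using (ℕ; zero; suc; z≤n; >-nonZero; _+_; _*_; _≤_; _<_; _⊔_; _≤′_; ≤′-refl; ≤′-step; s≤s; _≤?_; _≟_)
open import Data.Nat.Combinatorics using (_C_; nCk+nC[k+1]≡[n+1]C[k+1])
open import Data.Nat.Properties
  using (≤-trans; ≤-reflexive; <⇒≤; ≤⇒≯; ≰⇒>; ≤⇒≤′; +-mono-≤; +-monoˡ-≤; *-monoˡ-≤; +-identityʳ; +-suc;
         m<m+n; m≤m+n; m≤n+m; m≤m⊔n; suc-injective; m≤n⊔m; m≤m*n; module ≤-Reasoning)
open import Data.Product using (Σ; ∃; ∃₂; _×_; _,_; proj₁; proj₂)
import Data.Product as Product
open import Data.Sum using (_⊎_; inj₁; inj₂; [_,_]′)
import Data.Sum as Sum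
import Data.Sum.Effectful.Left as Left
open import Data.Vec using () renaming ([] to []ᵛ; _∷_ to _∷ᵛ_)
open import Data.Vec.Properties using (≡-dec; ∷-injectiveʳ)
open import Function using (_∘_; id)
open import Relation.Binary.Construct.Closure.Transitive
  using (TransClosure; [_]; _∷_; symmetric) renaming (_++_ to _++ᵗ_)
open import Relation.Binary.Definitions using (DecidableEquality)
open import Relation.Binary.PropositionalEquality using (_≡_; refl; sym; trans; subst; cong; cong₂; module ≡-Reasoning)
open import Relation.Nullary using (¬_; Dec; yes; no; ¬?)
open import Relation.Nullary.Decidable using (map′; _×-dec_; _⊎-dec_; decidable-stable)
open import Relation.Unary using (Decidable; _⊆_)

-- Transitive closures

TransClosure-exit : ∀ {A : Set} {R : A → A → Set} {P : A → Set} → Decidable P →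
                    ∀ {x y} → P x → ¬ P y → TransClosure R x y →
                    ∃₂ λ x' y' → P x' × ¬ P y' × R x' y'
TransClosure-exit P? {x} {y} px ¬py [ r ] = x , y , px , ¬py , r
TransClosure-exit P? px ¬py (_∷_ {y = z} r rest) with P? z
... | yes pz = TransClosure-exit P? pz ¬py rest
... | no ¬pz = _ , z , px , ¬pz , r

module TransClosureDecidable {A : Set} {R : A → A → Set} (R? : ∀ x y → Dec (R x y)) where

  data Via (W : List A) : A → A → Set where
    edge   : ∀ {x y} → R x y → Via W x y
    _∷⟨_⟩_ : ∀ {x z y} → R x z → z ∈ W → Via W z y → Via W x y

  Via-weaken : ∀ {w W x y} → Via W x y → Via (w ∷ W) x y
  Via-weaken (edge r)       = edge r
  Via-weaken (r ∷⟨ z∈ ⟩ p) = r ∷⟨ there z∈ ⟩ Via-weaken p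

  Via-++ : ∀ {W x w y} → Via W x w → w ∈ W → Via W w y → Via W x y
  Via-++ (edge r)       w∈ q = r ∷⟨ w∈ ⟩ q
  Via-++ (r ∷⟨ z∈ ⟩ p) w∈ q = r ∷⟨ z∈ ⟩ Via-++ p w∈ q

  Via-split : ∀ {w W x y} → Via (w ∷ W) x y → Via W x y ⊎ Via W x w × Via W w y
  Via-split (edge r)              = inj₁ (edge r)
  Via-split (r ∷⟨ here refl ⟩ p) = inj₂ (edge r , [ id , proj₂ ]′ (Via-split p))
  Via-split (r ∷⟨ there z∈ ⟩ p)  = Sum.map (r ∷⟨ z∈ ⟩_) (Product.map₁ (r ∷⟨ z∈ ⟩_)) (Via-split p)

  -- Floyd–Warshall: a path through w ∷ W either avoids w or splits at w.
  Via? : ∀ W x y → Dec (Via W x y)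
  Via? []      x y = map′ edge (λ { (edge r) → r ; (_ ∷⟨ () ⟩ _) }) (R? x y)
  Via? (w ∷ W) x y =
    map′ [ Via-weaken , (λ (p , q) → Via-++ (Via-weaken p) (here refl) (Via-weaken q)) ]′ Via-split
         (Via? W x y ⊎-dec (Via? W x w ×-dec Via? W w y))

  Via⇒TransClosure : ∀ {W x y} → Via W x y → TransClosure R x y
  Via⇒TransClosure (edge r)      = [ r ]
  Via⇒TransClosure (r ∷⟨ _ ⟩ p) = r ∷ Via⇒TransClosure p

  module _ {U : List A} (targets∈U : ∀ {x y} → R x y → y ∈ U) where

    TransClosure⇒Via : ∀ {x y} → TransClosure R x y → Via U x y
    TransClosure⇒Via [ r ]    = edge r
    TransClosure⇒Via (r ∷ rs) = r ∷⟨ targets∈U r ⟩ TransClosure⇒Via rs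

    TransClosure? : ∀ x y → Dec (TransClosure R x y)
    TransClosure? x y = map′ Via⇒TransClosure TransClosure⇒Via (Via? U x y)

-- Counting

Unique-length-≤ : ∀ {A : Set} {xs ys : List A} → Unique xs → (_∈ xs) ⊆ (_∈ ys) → length xs ≤ length ys
Unique-length-≤ {xs = []}     _          _     = z≤n
Unique-length-≤ {xs = x ∷ xs} (x∉xs ∷ u) xs⊆ys with ys₁ , ys₂ , refl ← ∈-∃++ (xs⊆ys (here refl)) =
  ≤-trans (s≤s (Unique-length-≤ u xs⊆ys₁++ys₂)) (≤-reflexive (sym (length-++-sucʳ ys₁ x ys₂)))
  where
  xs⊆ys₁++ys₂ : (_∈ xs) ⊆ (_∈ ys₁ ++ ys₂)
  xs⊆ys₁++ys₂ z∈xs with ∈-++⁻ ys₁ (xs⊆ys (there z∈xs))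
  ... | inj₁ z∈ys₁         = ∈-++⁺ˡ z∈ys₁
  ... | inj₂ (here refl)   = ⊥-elim (All.lookup x∉xs z∈xs refl)
  ... | inj₂ (there z∈ys₂) = ∈-++⁺ʳ ys₁ z∈ys₂

length-++-< : ∀ {A : Set} (xs : List A) {ys : List A} {y} → y ∈ ys → length xs < length (xs ++ ys)
length-++-< xs {ys} y∈ys = begin-strict
  length xs             <⟨ m<m+n (length xs) (∈-length y∈ys) ⟩
  length xs + length ys ≡⟨ length-++ xs ⟨
  length (xs ++ ys)     ∎
  where open ≤-Reasoning

1≤nCk : ∀ {n k} → k ≤ n → 1 ≤ n C k
1≤nCk {n}     {zero}  _         = ≤-reflexive refl
1≤nCk {suc n} {suc k} (s≤s k≤n) = ≤-trans (1≤nCk k≤n)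
  (≤-trans (m≤m+n (n C k) (n C suc k)) (≤-reflexive (nCk+nC[k+1]≡[n+1]C[k+1] n k)))

2≤nCk : ∀ {n k} → 1 ≤ k → k < n → 2 ≤ n C k
2≤nCk {suc n} {suc k} _ (s≤s k<n) =
  ≤-trans (+-mono-≤ (1≤nCk (<⇒≤ k<n)) (1≤nCk k<n)) (≤-reflexive (nCk+nC[k+1]≡[n+1]C[k+1] n k))

_≟ˢ_ : ∀ {n} → DecidableEquality (Subset n)
_≟ˢ_ = ≡-dec _≟ᵇ_

_∈?_ : ∀ {n} (x : Subset n) (xs : List (Subset n)) → Dec (x ∈ xs)
_∈?_ = DecMembership._∈?_ _≟ˢ_

subsetsOfSize : (n j : ℕ) → List (Subset n)
subsetsOfSize zero    zero    = []ᵛ ∷ []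
subsetsOfSize zero    (suc j) = []
subsetsOfSize (suc n) zero    = map (outside ∷ᵛ_) (subsetsOfSize n zero)
subsetsOfSize (suc n) (suc j) =
  map (inside ∷ᵛ_) (subsetsOfSize n j) ++ map (outside ∷ᵛ_) (subsetsOfSize n (suc j))

length-subsetsOfSize : ∀ n j → length (subsetsOfSize n j) ≡ n C j
length-subsetsOfSize zero    zero    = refl
length-subsetsOfSize zero    (suc j) = refl
length-subsetsOfSize (suc n) zero    =
  trans (length-map _ (subsetsOfSize n zero)) (length-subsetsOfSize n zero)
length-subsetsOfSize (suc n) (suc j) = begin
  length (map (inside ∷ᵛ_) (subsetsOfSize n j) ++ map (outside ∷ᵛ_) (subsetsOfSize n (suc j)))
    ≡⟨ length-++ (map (inside ∷ᵛ_) (subsetsOfSize n j)) ⟩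
  length (map (inside ∷ᵛ_) (subsetsOfSize n j)) + length (map (outside ∷ᵛ_) (subsetsOfSize n (suc j)))
    ≡⟨ cong₂ _+_ (length-map _ (subsetsOfSize n j)) (length-map _ (subsetsOfSize n (suc j))) ⟩
  length (subsetsOfSize n j) + length (subsetsOfSize n (suc j))
    ≡⟨ cong₂ _+_ (length-subsetsOfSize n j) (length-subsetsOfSize n (suc j)) ⟩
  n C j + n C suc j
    ≡⟨ nCk+nC[k+1]≡[n+1]C[k+1] n j ⟩
  suc n C suc j ∎
  where open ≡-Reasoning

subsetsOfSize-sizes : ∀ n j → All (n ⁽ j ⁾) (subsetsOfSize n j)
subsetsOfSize-sizes zero    zero    = refl ∷ []
subsetsOfSize-sizes zero    (suc j) = []
subsetsOfSize-sizes (suc n) zero    = map⁺ (subsetsOfSize-sizes n zero)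
subsetsOfSize-sizes (suc n) (suc j) =
  ++⁺ (map⁺ (All.map (cong suc) (subsetsOfSize-sizes n j))) (map⁺ (subsetsOfSize-sizes n (suc j)))

∈-subsetsOfSize : ∀ {n j} {x : Subset n} → ∣ x ∣ ≡ j → x ∈ subsetsOfSize n j
∈-subsetsOfSize {zero}  {zero}  {[]ᵛ} _ = here refl
∈-subsetsOfSize {suc n} {zero}  {outside ∷ᵛ x} ∣x∣≡0 = ∈-map⁺ (outside ∷ᵛ_) (∈-subsetsOfSize ∣x∣≡0)
∈-subsetsOfSize {suc n} {suc j} {inside ∷ᵛ x}  ∣x∣≡j =
  ∈-++⁺ˡ (∈-map⁺ (inside ∷ᵛ_) (∈-subsetsOfSize (suc-injective ∣x∣≡j)))
∈-subsetsOfSize {suc n} {suc j} {outside ∷ᵛ x} ∣x∣≡j =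
  ∈-++⁺ʳ (map (inside ∷ᵛ_) (subsetsOfSize n j)) (∈-map⁺ (outside ∷ᵛ_) (∈-subsetsOfSize ∣x∣≡j))

subsetsOfSize-unique : ∀ n j → Unique (subsetsOfSize n j)
subsetsOfSize-unique zero    zero    = [] ∷ []
subsetsOfSize-unique zero    (suc j) = []
subsetsOfSize-unique (suc n) zero    = Unique.map⁺ ∷-injectiveʳ (subsetsOfSize-unique n zero)
subsetsOfSize-unique (suc n) (suc j) =
  Unique.++⁺ (Unique.map⁺ ∷-injectiveʳ (subsetsOfSize-unique n j))
             (Unique.map⁺ ∷-injectiveʳ (subsetsOfSize-unique n (suc j)))
             inside≢outside
  where
  inside≢outside : Disjoint (map (inside ∷ᵛ_) (subsetsOfSize n j)) (map (outside ∷ᵛ_) (subsetsOfSize n (suc j)))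
  inside≢outside (v∈ins , v∈outs) with ∈-map⁻ _ v∈ins | ∈-map⁻ _ v∈outs
  ... | _ , _ , refl | _ , _ , ()

-- The jigsaw process

module ClusterProperties {n : ℕ} (𝒥 E₁ E₂ : Family n) where
  open Jigsaw 𝒥 E₁ E₂

  Same⇒𝒥ˡ : ∀ t {x y} → Same t x y → 𝒥 x
  Step⇒𝒥ˡ : ∀ t {x y} → Step t x y → 𝒥 x
  Same⇒𝒥ˡ zero    (x∈𝒥 , _) = x∈𝒥
  Same⇒𝒥ˡ (suc t) [ s ]     = Step⇒𝒥ˡ t s
  Same⇒𝒥ˡ (suc t) (s ∷ _)   = Step⇒𝒥ˡ t s
  Step⇒𝒥ˡ t (inj₁ s)                          = Same⇒𝒥ˡ t s
  Step⇒𝒥ˡ t (inj₂ (_ , _ , _ , _ , _ , s , _)) = Same⇒𝒥ˡ t s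

  Same-refl : ∀ t {x} → 𝒥 x → Same t x x
  Same-refl zero    x∈𝒥 = x∈𝒥 , refl
  Same-refl (suc t) x∈𝒥 = [ inj₁ (Same-refl t x∈𝒥) ]

  Same-sym : ∀ t {x y} → Same t x y → Same t y x
  Step-sym : ∀ t {x y} → Step t x y → Step t y x
  Same-sym zero    (x∈𝒥 , refl) = x∈𝒥 , refl
  Same-sym (suc t)               = symmetric (Step t) (Step-sym t)
  Step-sym t (inj₁ s) = inj₁ (Same-sym t s)
  Step-sym t (inj₂ (¬s , J₁ , J₂ , J₁' , J₂' , s₁ , s₂ , s₃ , s₄ , (e₁ , e₁∈ , c₁) , (e₂ , e₂∈ , c₂))) =
    inj₂ (¬s ∘ Same-sym t , J₁' , J₂' , J₁ , J₂ , s₃ , s₄ , s₁ , s₂ ,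
          (e₁ , e₁∈ , subst (S._⊆ e₁) (∪-comm J₁ J₁') c₁) ,
          (e₂ , e₂∈ , subst (S._⊆ e₂) (∪-comm J₂ J₂') c₂))

  Same⇒𝒥ʳ : ∀ t {x y} → Same t x y → 𝒥 y
  Same⇒𝒥ʳ t = Same⇒𝒥ˡ t ∘ Same-sym t

  Step⇒𝒥ʳ : ∀ t {x y} → Step t x y → 𝒥 y
  Step⇒𝒥ʳ t = Step⇒𝒥ˡ t ∘ Step-sym t

  Same-trans : ∀ t {x y z} → Same t x y → Same t y z → Same t x z
  Same-trans zero    (x∈𝒥 , refl) (_ , refl) = x∈𝒥 , refl
  Same-trans (suc t) s s'                     = s ++ᵗ s'

  Same-suc : ∀ t {x y} → Same t x y → Same (suc t) x y
  Same-suc t s = [ inj₁ s ]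

  Same-≤′ : ∀ {t t'} → t ≤′ t' → ∀ {x y} → Same t x y → Same t' x y
  Same-≤′ ≤′-refl       s = s
  Same-≤′ (≤′-step t≤t') s = Same-suc _ (Same-≤′ t≤t' s)

  Same-≤ : ∀ {t t'} → t ≤ t' → ∀ {x y} → Same t x y → Same t' x y
  Same-≤ = Same-≤′ ∘ ≤⇒≤′

module _ {n : ℕ} {𝒥 E₁ E₂ 𝒥' E₁' E₂' : Family n}
         (𝒥⊆𝒥' : 𝒥 ⊆ 𝒥') (E₁⊆E₁' : E₁ ⊆ E₁') (E₂⊆E₂' : E₂ ⊆ E₂') where
  private
    module A = Jigsaw 𝒥 E₁ E₂
    module B = Jigsaw 𝒥' E₁' E₂'

  -- Adj is antitone in the families through its ¬ Same conjunct, so monotonicity only holds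
  -- up to double negation: each step cases on whether the larger process already joined x and y.
  Same-mono : ∀ t {x y} → A.Same t x y → ¬ ¬ B.Same t x y
  Step-mono : ∀ t {x y} → A.Step t x y → ¬ ¬ B.Step t x y
  Same-mono zero    (x∈𝒥 , x≡y) k = k (𝒥⊆𝒥' x∈𝒥 , x≡y)
  Same-mono (suc t) [ s ]       k = Step-mono t s (k ∘ [_])
  Same-mono (suc t) (s ∷ ss)    k = Step-mono t s λ s' → Same-mono (suc t) ss (k ∘ (s' ∷_))
  Step-mono t (inj₁ s) k = Same-mono t s (k ∘ inj₁)
  Step-mono t (inj₂ (_ , J₁ , J₂ , J₁' , J₂' , s₁ , s₂ , s₃ , s₄ , (e₁ , e₁∈ , c₁) , (e₂ , e₂∈ , c₂))) k =
    Same-mono t s₁ λ s₁' → Same-mono t s₂ λ s₂' → Same-mono t s₃ λ s₃' → Same-mono t s₄ λ s₄' →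
      k (inj₂ (k ∘ inj₁ , J₁ , J₂ , J₁' , J₂' , s₁' , s₂' , s₃' , s₄' ,
               (e₁ , E₁⊆E₁' e₁∈ , c₁) , (e₂ , E₂⊆E₂' e₂∈ , c₂)))

module ClusterDecidability {n : ℕ} {𝒥 E₁ E₂ : Family n}
  (𝒥? : Decidable 𝒥) (E₁? : Decidable E₁) (E₂? : Decidable E₂)
  {U : List (Subset n)} (𝒥⊆U : 𝒥 ⊆ (_∈ U)) where
  open Jigsaw 𝒥 E₁ E₂
  open ClusterProperties 𝒥 E₁ E₂

  Same? : ∀ t x y → Dec (Same t x y)
  Step? : ∀ t x y → Dec (Step t x y)
  Adj?  : ∀ t x y → Dec (Adj t x y)
  Same? zero    x y = 𝒥? x ×-dec x ≟ˢ y
  Same? (suc t)     = TransClosureDecidable.TransClosure? (Step? t) (𝒥⊆U ∘ Step⇒𝒥ʳ t)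
  Step? t x y = Same? t x y ⊎-dec Adj? t x y
  Adj?  t x y = ¬? (Same? t x y) ×-dec
    anySubset? λ J₁ → anySubset? λ J₂ → anySubset? λ J₁' → anySubset? λ J₂' →
      Same? t x J₁ ×-dec Same? t x J₂ ×-dec Same? t y J₁' ×-dec Same? t y J₂' ×-dec
      anySubset? (λ e₁ → E₁? e₁ ×-dec (J₁ ∪ J₁') ⊆? e₁) ×-dec
      anySubset? (λ e₂ → E₂? e₂ ×-dec (J₂ ∪ J₂') ⊆? e₂)

-- Finite edge support

module EdgeSupport {n : ℕ} (𝒥 E₁ E₂ : Family n) where
  open Jigsaw 𝒥 E₁ E₂

  EdgePair : Set
  EdgePair = Σ (Subset n) E₁ × Σ (Subset n) E₂

  Covers : Family n → Family n → List EdgePair → Set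
  Covers ℰ₁ ℰ₂ = All λ ((e₁ , _) , (e₂ , _)) → ℰ₁ e₁ × ℰ₂ e₂

  usedEdges     : ∀ t {x y} → Same t x y → List EdgePair
  usedEdgesStep : ∀ t {x y} → Step t x y → List EdgePair
  usedEdges zero    _        = []
  usedEdges (suc t) [ s ]    = usedEdgesStep t s
  usedEdges (suc t) (s ∷ ss) = usedEdgesStep t s ++ usedEdges (suc t) ss
  usedEdgesStep t (inj₁ s) = usedEdges t s
  usedEdgesStep t (inj₂ (_ , _ , _ , _ , _ , s₁ , s₂ , s₃ , s₄ , (e₁ , e₁∈ , _) , (e₂ , e₂∈ , _))) =
    ((e₁ , e₁∈) , (e₂ , e₂∈)) ∷ usedEdges t s₁ ++ usedEdges t s₂ ++ usedEdges t s₃ ++ usedEdges t s₄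

  module _ {ℰ₁ ℰ₂ : Family n} (ℰ₁⊆E₁ : ℰ₁ ⊆ E₁) (ℰ₂⊆E₂ : ℰ₂ ⊆ E₂) where
    private module R = Jigsaw 𝒥 ℰ₁ ℰ₂

    Same-restrict : ∀ t {x y} (s : Same t x y) → Covers ℰ₁ ℰ₂ (usedEdges t s) → R.Same t x y
    Step-restrict : ∀ t {x y} (s : Step t x y) → Covers ℰ₁ ℰ₂ (usedEdgesStep t s) → R.Step t x y
    Same-restrict zero    s        _   = s
    Same-restrict (suc t) [ s ]    cov = [ Step-restrict t s cov ]
    Same-restrict (suc t) (s ∷ ss) cov =
      Step-restrict t s (++⁻ˡ _ cov) ∷ Same-restrict (suc t) ss (++⁻ʳ (usedEdgesStep t s) cov)
    Step-restrict t (inj₁ s) cov = inj₁ (Same-restrict t s cov)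
    Step-restrict t (inj₂ (¬s , J₁ , J₂ , J₁' , J₂' , s₁ , s₂ , s₃ , s₄ , (e₁ , _ , c₁) , (e₂ , _ , c₂)))
                  ((e₁∈ℰ₁ , e₂∈ℰ₂) ∷ cov)
      with cov₁ , cov₂₃₄ ← ++⁻ (usedEdges t s₁) cov
      with cov₂ , cov₃₄  ← ++⁻ (usedEdges t s₂) cov₂₃₄
      with cov₃ , cov₄   ← ++⁻ (usedEdges t s₃) cov₃₄ =
      inj₂ ((λ s → Same-mono id ℰ₁⊆E₁ ℰ₂⊆E₂ t s ¬s) , J₁ , J₂ , J₁' , J₂' ,
            Same-restrict t s₁ cov₁ , Same-restrict t s₂ cov₂ , Same-restrict t s₃ cov₃ , Same-restrict t s₄ cov₄ ,
            (e₁ , e₁∈ℰ₁ , c₁) , (e₂ , e₂∈ℰ₂ , c₂))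

  redEdges blueEdges : List EdgePair → Family n
  redEdges  L e = e ∈ map (proj₁ ∘ proj₁) L
  blueEdges L e = e ∈ map (proj₁ ∘ proj₂) L

  redEdges⊆E₁ : ∀ L → redEdges L ⊆ E₁
  redEdges⊆E₁ L e∈ with (((_ , e∈E₁) , _) , _ , refl) ← ∈-map⁻ (proj₁ ∘ proj₁) e∈ = e∈E₁

  blueEdges⊆E₂ : ∀ L → blueEdges L ⊆ E₂
  blueEdges⊆E₂ L e∈ with ((_ , (_ , e∈E₂)) , _ , refl) ← ∈-map⁻ (proj₁ ∘ proj₂) e∈ = e∈E₂

  redEdges? : ∀ L → Decidable (redEdges L)
  redEdges? L e = e ∈? map (proj₁ ∘ proj₁) L

  blueEdges? : ∀ L → Decidable (blueEdges L)
  blueEdges? L e = e ∈? map (proj₁ ∘ proj₂) L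

  Covers-⊆ : ∀ {L L'} → (_∈ L') ⊆ (_∈ L) → Covers (redEdges L) (blueEdges L) L'
  Covers-⊆ L'⊆L = All.tabulate λ p∈ → ∈-map⁺ (proj₁ ∘ proj₁) (L'⊆L p∈) , ∈-map⁺ (proj₁ ∘ proj₂) (L'⊆L p∈)

  usedEdgesAll : ∀ {t x Ks} → All (Same t x) Ks → List EdgePair
  usedEdgesAll []       = []
  usedEdgesAll (s ∷ ss) = usedEdges _ s ++ usedEdgesAll ss

  Same-finitary : ∀ {t x Ks} (ss : All (Same t x) Ks) →
                  All (Jigsaw.Same 𝒥 (redEdges (usedEdgesAll ss)) (blueEdges (usedEdgesAll ss)) t x) Ks
  Same-finitary {t} {x} ss = restrictAll ss id
    where
    L = usedEdgesAll ss
    restrictAll : ∀ {Ks} (ss' : All (Same t x) Ks) → (_∈ usedEdgesAll ss') ⊆ (_∈ L) →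
                  All (Jigsaw.Same 𝒥 (redEdges L) (blueEdges L) t x) Ks
    restrictAll []        _    = []
    restrictAll (s ∷ ss') ⊆L =
      Same-restrict (redEdges⊆E₁ L) (blueEdges⊆E₂ L) t s (Covers-⊆ (⊆L ∘ ∈-++⁺ˡ)) ∷
      restrictAll ss' (⊆L ∘ ∈-++⁺ʳ (usedEdges t s))

-- Internally spanned families

module Spanning {n j : ℕ} {ℰ₁ ℰ₂ : Family n} (ℰ₁? : Decidable ℰ₁) (ℰ₂? : Decidable ℰ₂) where

  InternallySpanned : List (Subset n) → Set
  InternallySpanned A = Unique A × All (n ⁽ j ⁾) A × Percolates (_∈ A) ℰ₁ ℰ₂

  Linked : Family n → List (Subset n) → List (Subset n) → Set
  Linked E A B = ∃₂ λ a b → a ∈ A × b ∈ B × ∃ λ e → E e × (a ∪ b) S.⊆ e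

  Same∈? : ∀ A t x y → Dec (Jigsaw.Same (_∈ A) ℰ₁ ℰ₂ t x y)
  Same∈? A = ClusterDecidability.Same? (_∈? A) ℰ₁? ℰ₂? id

  Same-⊆ : ∀ {A B} → (_∈ A) ⊆ (_∈ B) → ∀ t {x y} →
           Jigsaw.Same (_∈ A) ℰ₁ ℰ₂ t x y → Jigsaw.Same (_∈ B) ℰ₁ ℰ₂ t x y
  Same-⊆ A⊆B t s = decidable-stable (Same∈? _ t _ _) (Same-mono A⊆B id id t s)

  singleton-spanned : ∀ {J} → ∣ J ∣ ≡ j → InternallySpanned (J ∷ [])
  singleton-spanned ∣J∣≡j = [] ∷ [] , ∣J∣≡j ∷ [] , (_ , here refl) , 0 , λ { _ _ (here refl) (here refl) → here refl , refl }

  -- By time tA ⊔ tB each part is a single cluster; one more step joins them along the two links.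
  ++-spanned : ∀ {A B} → InternallySpanned A → InternallySpanned B → Disjoint A B →
               Linked ℰ₁ A B → Linked ℰ₂ A B → InternallySpanned (A ++ B)
  ++-spanned {A} {B} (uA , ∣A∣ , (a , a∈) , tA , percA) (uB , ∣B∣ , _ , tB , percB) A#B
             (a₁ , b₁ , a₁∈ , b₁∈ , red) (a₂ , b₂ , a₂∈ , b₂∈ , blue) =
    Unique.++⁺ uA uB A#B , ++⁺ ∣A∣ ∣B∣ , (a , ∈-++⁺ˡ a∈) , suc T , joined
    where
    open Jigsaw (_∈ A ++ B) ℰ₁ ℰ₂
    open ClusterProperties (_∈ A ++ B) ℰ₁ ℰ₂
    T = tA ⊔ tB

    inA : ∀ {x y} → x ∈ A → y ∈ A → Same T x y
    inA x∈ y∈ = Same-≤ (m≤m⊔n tA tB) (Same-⊆ ∈-++⁺ˡ tA (percA _ _ x∈ y∈))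

    inB : ∀ {x y} → x ∈ B → y ∈ B → Same T x y
    inB x∈ y∈ = Same-≤ (m≤n⊔m tA tB) (Same-⊆ (∈-++⁺ʳ A) tB (percB _ _ x∈ y∈))

    across : ∀ {x y} → x ∈ A → y ∈ B → Same (suc T) x y
    across {x} {y} x∈ y∈ with Same∈? (A ++ B) T x y
    ... | yes s = Same-suc T s
    ... | no ¬s = [ inj₂ (¬s , a₁ , a₂ , b₁ , b₂ , inA x∈ a₁∈ , inA x∈ a₂∈ , inB y∈ b₁∈ , inB y∈ b₂∈ , red , blue) ]

    joined : ∀ x y → x ∈ A ++ B → y ∈ A ++ B → Same (suc T) x y
    joined x y x∈ y∈ with ∈-++⁻ A x∈ | ∈-++⁻ A y∈
    ... | inj₁ x∈A | inj₁ y∈A = Same-suc T (inA x∈A y∈A)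
    ... | inj₂ x∈B | inj₂ y∈B = Same-suc T (inB x∈B y∈B)
    ... | inj₁ x∈A | inj₂ y∈B = across x∈A y∈B
    ... | inj₂ x∈B | inj₁ y∈A = Same-sym (suc T) (across y∈A x∈B)

  module Growth (N c : ℕ) (1≤N : 1 ≤ N) (2≤c : 2 ≤ c) where
    private
      module P = Jigsaw (n ⁽ j ⁾) ℰ₁ ℰ₂
      open ClusterProperties (n ⁽ j ⁾) ℰ₁ ℰ₂

      Same? : ∀ t x y → Dec (P.Same t x y)
      Same? = ClusterDecidability.Same? (λ x → ∣ x ∣ ≟ j) ℰ₁? ℰ₂? ∈-subsetsOfSize

    SpannedInRange : Set
    SpannedInRange = ∃ λ A → InternallySpanned A × N ≤ length A × length A ≤ c * N

    IsCluster : ℕ → Subset n → List (Subset n) → Set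
    IsCluster t J A = (∀ {K} → K ∈ A → P.Same t J K) × (∀ {K} → P.Same t J K → K ∈ A)

    SmallCluster : ℕ → Subset n → Set
    SmallCluster t J = ∃ λ A → InternallySpanned A × length A < N × IsCluster t J A

    AllClustersSmall : ℕ → Set
    AllClustersSmall t = ∀ J → ∣ J ∣ ≡ j → SmallCluster t J

    Invariant : ℕ → Set
    Invariant t = SpannedInRange ⊎ AllClustersSmall t

    N+N≤c*N : N + N ≤ c * N
    N+N≤c*N = ≤-trans (≤-reflexive (cong (N +_) (sym (+-identityʳ N)))) (*-monoˡ-≤ N 2≤c)

    length-++-≤ : ∀ (A : List (Subset n)) {B} → length A < N → length B < N → length (A ++ B) ≤ c * N
    length-++-≤ A {B} ∣A∣<N ∣B∣<N = begin
      length (A ++ B)     ≡⟨ length-++ A ⟩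
      length A + length B ≤⟨ +-mono-≤ (<⇒≤ ∣A∣<N) (<⇒≤ ∣B∣<N) ⟩
      N + N               ≤⟨ N+N≤c*N ⟩
      c * N               ∎
      where open ≤-Reasoning

    invariant-zero : Σ (Subset n) (n ⁽ j ⁾) → Invariant 0
    invariant-zero (J₀ , ∣J₀∣≡j) with N ≤? 1
    ... | yes N≤1 = inj₁ (J₀ ∷ [] , singleton-spanned ∣J₀∣≡j , N≤1 , ≤-trans 1≤N (≤-trans (m≤m+n N N) N+N≤c*N))
    ... | no  N≰1 = inj₂ λ J ∣J∣≡j → J ∷ [] , singleton-spanned ∣J∣≡j , ≰⇒> N≰1 ,
                                   (λ { (here refl) → ∣J∣≡j , refl }) , (λ { (_ , refl) → here refl })

    module Absorption {t} (small : AllClustersSmall t) (J : Subset n) where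

      -- A union of time-t clusters inside the time-(t+1) cluster of J.
      record Seed (A : List (Subset n)) : Set where
        field
          spanned : InternallySpanned A
          root    : J ∈ A
          within  : ∀ {K} → K ∈ A → P.Same (suc t) J K
          closed  : ∀ {x z} → x ∈ A → P.Same t x z → z ∈ A

      seed : ∣ J ∣ ≡ j → ∃ λ A → length A < N × Seed A
      seed ∣J∣≡j with A , spanned , ∣A∣<N , A⊆ , ⊆A ← small J ∣J∣≡j =
        A , ∣A∣<N , record
          { spanned = spanned
          ; root    = ⊆A (Same-refl t ∣J∣≡j)
          ; within  = Same-suc t ∘ A⊆
          ; closed  = λ x∈ s → ⊆A (Same-trans t (A⊆ x∈) s)
          }

      absorb : ∀ {A x y} → length A < N → Seed A → x ∈ A → y ∉ A → P.Step t x y →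
               ∃ λ A' → length A < length A' × length A' ≤ c * N × Seed A'
      absorb ∣A∣<N seed x∈ y∉ (inj₁ s) = ⊥-elim (y∉ (Seed.closed seed x∈ s))
      absorb {A} ∣A∣<N seed x∈ y∉
             st@(inj₂ (_ , J₁ , J₂ , J₁' , J₂' , s₁ , s₂ , s₃ , s₄ , red , blue))
        with B , spannedB , ∣B∣<N , B⊆ , ⊆B ← small _ (Same⇒𝒥ˡ t s₃) =
        A ++ B , length-++-< A y∈B , length-++-≤ A ∣A∣<N ∣B∣<N , record
          { spanned = ++-spanned spanned spannedB A#B
                        (J₁ , J₁' , closed x∈ s₁ , ⊆B s₃ , red) (J₂ , J₂' , closed x∈ s₂ , ⊆B s₄ , blue)
          ; root    = ∈-++⁺ˡ root
          ; within  = within′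
          ; closed  = closed′
          }
        where
        open Seed seed

        y∈B : _ ∈ B
        y∈B = ⊆B (Same-refl t (Same⇒𝒥ˡ t s₃))

        A#B : Disjoint A B
        A#B (v∈A , v∈B) = y∉ (closed v∈A (Same-sym t (B⊆ v∈B)))

        within′ : ∀ {K} → K ∈ A ++ B → P.Same (suc t) J K
        within′ K∈ with ∈-++⁻ A K∈
        ... | inj₁ K∈A = within K∈A
        ... | inj₂ K∈B = within x∈ ++ᵗ (st ∷ [ inj₁ (B⊆ K∈B) ])

        closed′ : ∀ {x z} → x ∈ A ++ B → P.Same t x z → z ∈ A ++ B
        closed′ x∈ s with ∈-++⁻ A x∈
        ... | inj₁ x∈A = ∈-++⁺ˡ (closed x∈A s)
        ... | inj₂ x∈B = ∈-++⁺ʳ A (⊆B (Same-trans t (B⊆ x∈B) s))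

      grow : ∀ fuel {A} → N ≤ length A + fuel → length A < N → Seed A →
             SpannedInRange ⊎ SmallCluster (suc t) J
      grow zero {A} N≤∣A∣+0 ∣A∣<N _ = ⊥-elim (≤⇒≯ (≤-trans N≤∣A∣+0 (≤-reflexive (+-identityʳ (length A)))) ∣A∣<N)
      grow (suc fuel) {A} N≤∣A∣+fuel ∣A∣<N seed
        with any? (λ K → Same? (suc t) J K ×-dec ¬? (K ∈? A)) (subsetsOfSize n j)
      ... | no ¬escape = inj₂ (A , spanned , ∣A∣<N , within , complete)
        where
        open Seed seed
        complete : ∀ {K} → P.Same (suc t) J K → K ∈ A
        complete {K} s = decidable-stable (K ∈? A)
          λ K∉A → ¬escape (lose (∈-subsetsOfSize (Same⇒𝒥ʳ (suc t) s)) (s , K∉A))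
      ... | yes escape
        with K , _ , s , K∉A ← find escape
        with x , y , x∈A , y∉A , st ← TransClosure-exit (_∈? A) (Seed.root seed) K∉A s
        with A' , ∣A∣<∣A'∣ , ∣A'∣≤c*N , seed' ← absorb ∣A∣<N seed x∈A y∉A st
        with N ≤? length A'
      ... | yes N≤∣A'∣ = inj₁ (A' , Seed.spanned seed' , N≤∣A'∣ , ∣A'∣≤c*N)
      ... | no  N≰∣A'∣ = grow fuel N≤∣A'∣+fuel (≰⇒> N≰∣A'∣) seed'
        where
        open ≤-Reasoning
        N≤∣A'∣+fuel : N ≤ length A' + fuel
        N≤∣A'∣+fuel = begin
          N                      ≤⟨ N≤∣A∣+fuel ⟩
          length A + suc fuel    ≡⟨ +-suc (length A) fuel ⟩
          suc (length A) + fuel  ≤⟨ +-monoˡ-≤ fuel ∣A∣<∣A'∣ ⟩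
          length A' + fuel       ∎

      cluster : ∣ J ∣ ≡ j → SpannedInRange ⊎ SmallCluster (suc t) J
      cluster ∣J∣≡j with A , ∣A∣<N , seedA ← seed ∣J∣≡j = grow N (m≤n+m N (length A)) ∣A∣<N seedA

    invariant-suc : ∀ t → Invariant t → Invariant (suc t)
    invariant-suc t (inj₁ spanned) = inj₁ spanned
    invariant-suc t (inj₂ small) =
      Sum.map₂ (λ clusters J ∣J∣≡j → All.lookup clusters (∈-subsetsOfSize {x = J} ∣J∣≡j))
        (All.sequenceA 0ℓ (Left.applicative SpannedInRange 0ℓ)
          (All.tabulate λ {J} J∈ → Absorption.cluster small J (All.lookup (subsetsOfSize-sizes n j) J∈)))

    invariant : Σ (Subset n) (n ⁽ j ⁾) → ∀ t → Invariant t
    invariant J₀ zero    = invariant-zero J₀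
    invariant J₀ (suc t) = invariant-suc t (invariant J₀ t)

    spannedInRange : ∀ {t} J₀ → ∣ J₀ ∣ ≡ j → N ≤ n C j → All (P.Same t J₀) (subsetsOfSize n j) → SpannedInRange
    spannedInRange {t} J₀ ∣J₀∣≡j N≤nCj percolates with invariant (J₀ , ∣J₀∣≡j) t
    ... | inj₁ spanned = spanned
    ... | inj₂ small with A , _ , ∣A∣<N , _ , ⊆A ← small J₀ ∣J₀∣≡j = ⊥-elim (≤⇒≯ N≤∣A∣ ∣A∣<N)
      where
      open ≤-Reasoning
      N≤∣A∣ : N ≤ length A
      N≤∣A∣ = begin
        N                            ≤⟨ N≤nCj ⟩
        n C j                        ≡⟨ length-subsetsOfSize n j ⟨
        length (subsetsOfSize n j)   ≤⟨ Unique-length-≤ (subsetsOfSize-unique n j)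
                                          (⊆A ∘ All.lookup percolates) ⟩
        length A                     ∎

claim2p1 : (n j k : ℕ) → 1 ≤ j → j < k → (H : DoubleGraph n k) →
    (N : ℕ) → 1 ≤ N → N * (k C j) ≤ n C j →
    JPercolates j H →
    Σ (List (Subset n)) λ 𝒥₀ → Σ (Family n) λ ℰ₁ → Σ (Family n) λ ℰ₂ →
      Unique 𝒥₀ × All (n ⁽ j ⁾) 𝒥₀ ×
      (∀ e → ℰ₁ e → DoubleGraph.E₁ H e) × (∀ e → ℰ₂ e → DoubleGraph.E₂ H e) ×
      Percolates (λ J → J ∈ 𝒥₀) ℰ₁ ℰ₂ ×
      N ≤ length 𝒥₀ × length 𝒥₀ ≤ (k C j) * N
claim2p1 n j k 1≤j j<k H N 1≤N N*kCj≤nCj ((J₀ , ∣J₀∣≡j) , T , percolates) =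
  let A , (unique , sizes , spanned) , N≤∣A∣ , ∣A∣≤kCj*N =
        spannedInRange J₀ ∣J₀∣≡j N≤nCj (Same-finitary H-percolates)
  in A , redEdges L , blueEdges L , unique , sizes , (λ _ → redEdges⊆E₁ L) , (λ _ → blueEdges⊆E₂ L) ,
     spanned , N≤∣A∣ , ∣A∣≤kCj*N
  where
  open EdgeSupport (n ⁽ j ⁾) (DoubleGraph.E₁ H) (DoubleGraph.E₂ H)

  H-percolates : All (Jigsaw.Same (n ⁽ j ⁾) (DoubleGraph.E₁ H) (DoubleGraph.E₂ H) T J₀) (subsetsOfSize n j)
  H-percolates = All.tabulate λ K∈ → percolates J₀ _ ∣J₀∣≡j (All.lookup (subsetsOfSize-sizes n j) K∈)

  L : List EdgePair
  L = usedEdgesAll H-percolates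

  2≤kCj : 2 ≤ k C j
  2≤kCj = 2≤nCk 1≤j j<k

  N≤nCj : N ≤ n C j
  N≤nCj = ≤-trans (m≤m*n N (k C j) ⦃ >-nonZero (≤-trans (s≤s z≤n) 2≤kCj) ⦄) N*kCj≤nCj

  open Spanning {j = j} (redEdges? L) (blueEdges? L)
  open Growth N (k C j) 1≤N 2≤kCj
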